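{- Let $C\ge 1$ be an integer, let $H=(L,F)$ be a finite directed graph in which every node has indegree at most $C$, and let $d\in\mathbb Z_{\ge 0}$. Define $\tau(u,i)$ for $u\in L$, $0\le i\le d$ by downward recursion on $i$: \[\tau(u,i)=\begin{cases}1 & \text{if } i=d,\\ C^{d-i}-\displaystyle\sum_{j=i+1}^{d}\ \sum_{v\in L:\ d_H(v,u)=j-i}\tau(v,j) & \text{otherwise.}\end{cases}\] Then for every $u\in L$ and $0\le i\le d$, \[\sum_{j=i}^{d}\ \sum_{v\in L:\ d_H(v,u)=j-i}\tau(v,j)=C^{d-i}\quad\text{and}\quad 0\le\tau(u,i)\le C^{d-i}.\]
   Context: $d_H(v,u)$ denotes the number of edges of a shortest directed path from $v$ to $u$ in $H$ ($\infty$ if none exists; $d_H(u,u)=0$). -}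

module Defs where

open import Data.Bool using (Bool; true; false; _∧_; _∨_; not; if_then_else_)
open import Data.Nat using (ℕ; zero; suc; _∸_; _≤ᵇ_; _≡ᵇ_)
open import Data.Fin using (Fin)
open import Data.Fin.Properties using (_≟_)
open import Data.List using (List; []; _∷_; foldr; map; length; filterᵇ; allFin; upTo)
open import Data.Integer using (ℤ; +_; _+_; _-_; _^_)
open import Relation.Nullary.Decidable using (⌊_⌋)

-- A finite directed graph H = (L, F) with node set L = Fin n,
-- given by its (decidable) edge relation: E v u = true iff (v → u) ∈ F.
Digraph : ℕ → Set
Digraph n = Fin n → Fin n → Bool

indeg : ∀ {n} → Digraph n → Fin n → ℕ
indeg {n} E u = length (filterᵇ (λ v → E v u) (allFin n))

anyNode : ∀ {n} → (Fin n → Bool) → Bool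
anyNode {n} p = foldr (λ v b → p v ∨ b) false (allFin n)

reach : ∀ {n} → Digraph n → ℕ → Fin n → Fin n → Bool
reach E zero    v u = ⌊ v ≟ u ⌋
reach E (suc k) v u = reach E k v u ∨ anyNode (λ w → reach E k v w ∧ E w u)

distIs : ∀ {n} → Digraph n → ℕ → Fin n → Fin n → Bool
distIs E zero    v u = reach E zero v u
distIs E (suc k) v u = reach E (suc k) v u ∧ not (reach E k v u)

sumℤ : List ℤ → ℤ
sumℤ = foldr _+_ (+ 0)

ΣL : ∀ {n} → (Fin n → ℤ) → ℤ
ΣL {n} f = sumℤ (map f (allFin n))

-- Σ_{j = a}^{b} f j  (empty if b < a)
Σrange : ℕ → ℕ → (ℕ → ℤ) → ℤ
Σrange a b f = sumℤ (map (λ k → f (a Data.Nat.+ k)) (upTo (suc b ∸ a)))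

ΣatDist : ∀ {n} → Digraph n → ℕ → Fin n → (Fin n → ℤ) → ℤ
ΣatDist E k u g = ΣL (λ v → if distIs E k v u then g v else + 0)

-- Writing σ t u = τ(u, d - t),
-- the recursion reads
--   σ 0 u = 1,
--   σ t u = C^t - Σ_{k=1}^{t} Σ_{v : d_H(v,u)=k} σ (t-k) v     (t ≥ 1).
-- tbl C E t s u = σ s u for all s ≤ t.
tbl : ∀ {n} → ℕ → Digraph n → ℕ → ℕ → Fin n → ℤ
tbl C E zero    s u = + 1
tbl C E (suc t) s u =
  if s ≤ᵇ t then tbl C E t s u
  else ((+ C) ^ suc t) - Σrange 1 (suc t) (λ k → ΣatDist E k u (tbl C E t (suc t ∸ k)))

τ : ∀ {n} → ℕ → Digraph n → ℕ → Fin n → ℕ → ℤ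
τ C E d u i = tbl C E (d ∸ i) (d ∸ i) u

-- Write S(t, u) for the left-hand sum at i = d − t.  Its j = i term is τ(u, i) and its
-- j > i terms are exactly what the recursion subtracts from C^t, so S(t, u) = C^t on every
-- graph.  Nonnegativity of τ(u, i) follows by induction on t = d − i: a node at distance
-- k + 1 from u is at distance k from some in-neighbour w of u, so the subtracted sum is at
-- most Σ_{w → u} S(t − 1, w) = indeg(u) · C^(t−1) ≤ C^t.  Once all τ are nonnegative, the
-- subtracted sum is too, which gives τ(u, i) ≤ C^t.
module Submission where

open import Defs
open import Data.Nat using (ℕ; _≤_; _∸_)
open import Data.Fin using (Fin)
open import Data.Integer using (ℤ; +_; _^_) renaming (_≤_ to _≤ℤ_)
open import Data.Product using (_×_)
open import Relation.Binary.PropositionalEquality using (_≡_)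

open import Data.Bool using (Bool; true; false; T; if_then_else_; _∧_; _∨_)
open import Data.Bool.Properties using (T-∧; T-∨; if-cong)
open import Data.Empty using (⊥-elim)
import Data.Fin as Fin
open import Data.Fin.Properties using (_≟_)
open import Data.Integer using (_+_; _-_; _*_; +≤+; nonNegative)
import Data.Integer.Properties as ℤ
open import Data.List using (List; []; _∷_; map; length; filterᵇ; allFin; upTo)
open import Data.Bool.ListAction using (any)
open import Data.List.Properties using (foldr-map; map-applyUpTo; map-upTo; map-tabulate)
open import Data.List.Membership.Propositional using (_∈_; lose)
open import Data.List.Membership.Propositional.Properties using (∈-allFin)
open import Data.List.Relation.Unary.Any using (here; there; satisfied)
open import Data.List.Relation.Unary.Any.Properties using (any⁺; any⁻)
import Data.Nat as ℕ
open import Data.Nat using (zero; suc; z≤n; s≤s; _≤ᵇ_; _≤?_)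
import Data.Nat.Properties as ℕ
open import Data.Product using (_,_; proj₁; ∃-syntax)
open import Data.Sum using (inj₁; inj₂)
open import Function using (_∘_)
open import Function.Bundles using (Equivalence)
open import Relation.Nullary using (¬_; yes; no)
open import Relation.Nullary.Decidable using (⌊_⌋; dec-false)
open import Relation.Binary.PropositionalEquality using (refl; sym; trans; cong; cong₂; subst; module ≡-Reasoning)
open import Algebra.Properties.AbelianGroup ℤ.+-0-abelianGroup using (//-rightDividesˡ)
open import Algebra.Properties.CommutativeSemigroup ℤ.+-commutativeSemigroup using (interchange)

open Equivalence using (to; from)

private
  variable
    A B : Set
    n : ℕ

-- Agrees definitionally with the conditionals in Defs, so ΣatDist E k u g unfolds to
-- ΣL (λ v → g v when distIs E k v u).
infix 5 _when_

_when_ : ℤ → Bool → ℤ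
x when b = if b then x else + 0

when-true : ∀ {b} x → T b → x when b ≡ x
when-true {true} x _ = refl

when-nonneg : ∀ b {x} → + 0 ≤ℤ x → + 0 ≤ℤ (x when b)
when-nonneg true  0≤x = 0≤x
when-nonneg false _   = ℤ.≤-refl

sumℤ-cong : (xs : List A) {f g : A → ℤ} → (∀ a → f a ≡ g a) →
            sumℤ (map f xs) ≡ sumℤ (map g xs)
sumℤ-cong []       f≗g = refl
sumℤ-cong (x ∷ xs) f≗g = cong₂ _+_ (f≗g x) (sumℤ-cong xs f≗g)

sumℤ-mono : (xs : List A) {f g : A → ℤ} → (∀ a → f a ≤ℤ g a) →
            sumℤ (map f xs) ≤ℤ sumℤ (map g xs)
sumℤ-mono []       f≤g = ℤ.≤-refl
sumℤ-mono (x ∷ xs) f≤g = ℤ.+-mono-≤ (f≤g x) (sumℤ-mono xs f≤g)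

sumℤ-nonneg : (xs : List A) {f : A → ℤ} → (∀ a → + 0 ≤ℤ f a) → + 0 ≤ℤ sumℤ (map f xs)
sumℤ-nonneg []       0≤f = ℤ.≤-refl
sumℤ-nonneg (x ∷ xs) 0≤f = ℤ.+-mono-≤ (0≤f x) (sumℤ-nonneg xs 0≤f)

sumℤ-zero : (xs : List A) → sumℤ (map (λ _ → + 0) xs) ≡ + 0
sumℤ-zero []       = refl
sumℤ-zero (x ∷ xs) = trans (ℤ.+-identityˡ _) (sumℤ-zero xs)

sumℤ-+ : (xs : List A) (f g : A → ℤ) →
         sumℤ (map (λ a → f a + g a) xs) ≡ sumℤ (map f xs) + sumℤ (map g xs)
sumℤ-+ []       f g = refl
sumℤ-+ (x ∷ xs) f g =
  trans (cong (_+_ (f x + g x)) (sumℤ-+ xs f g)) (interchange (f x) (g x) _ _)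

sumℤ-swap : (xs : List A) (ys : List B) (g : A → B → ℤ) →
            sumℤ (map (λ a → sumℤ (map (g a) ys)) xs) ≡
            sumℤ (map (λ b → sumℤ (map (λ a → g a b) xs)) ys)
sumℤ-swap []       ys g = sym (sumℤ-zero ys)
sumℤ-swap (x ∷ xs) ys g =
  trans (cong (_+_ (sumℤ (map (g x) ys))) (sumℤ-swap xs ys g))
        (sym (sumℤ-+ ys (g x) (λ b → sumℤ (map (λ a → g a b) xs))))

sumℤ-when : ∀ b (xs : List A) (f : A → ℤ) →
            sumℤ (map (λ a → f a when b) xs) ≡ sumℤ (map f xs) when b
sumℤ-when true  xs f = refl
sumℤ-when false xs f = sumℤ-zero xs

sumℤ-const-when : (p : A → Bool) (xs : List A) (m : ℕ) →
                  sumℤ (map (λ a → + m when p a) xs) ≡ + (length (filterᵇ p xs) ℕ.* m)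
sumℤ-const-when p []       m = refl
sumℤ-const-when p (x ∷ xs) m with p x
... | true  = cong (_+_ (+ m)) (sumℤ-const-when p xs m)
... | false = trans (ℤ.+-identityˡ _) (sumℤ-const-when p xs m)

sumℤ-upTo-suc : (f : ℕ → ℤ) (m : ℕ) →
                sumℤ (map f (upTo (suc m))) ≡ f 0 + sumℤ (map (f ∘ suc) (upTo m))
sumℤ-upTo-suc f m =
  cong (λ xs → f 0 + sumℤ xs) (trans (map-applyUpTo suc f m) (sym (map-upTo (f ∘ suc) m)))

≤-sumℤ : (xs : List A) (f : A → ℤ) {x : A} → x ∈ xs → (∀ a → + 0 ≤ℤ f a) →
         f x ≤ℤ sumℤ (map f xs)
≤-sumℤ (y ∷ xs) f (here refl) 0≤f =
  subst (_≤ℤ f y + sumℤ (map f xs)) (ℤ.+-identityʳ (f y)) (ℤ.+-monoʳ-≤ (f y) (sumℤ-nonneg xs 0≤f))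
≤-sumℤ (y ∷ xs) f (there x∈xs) 0≤f =
  subst (_≤ℤ f y + sumℤ (map f xs)) (ℤ.+-identityˡ _) (ℤ.+-mono-≤ (0≤f y) (≤-sumℤ xs f x∈xs 0≤f))

ΣL-suc : (f : Fin (suc n) → ℤ) → ΣL f ≡ f Fin.zero + ΣL (f ∘ Fin.suc)
ΣL-suc {n} f = cong (λ xs → f Fin.zero + sumℤ xs)
  (trans (map-tabulate Fin.suc f) (sym (map-tabulate (λ v → v) (f ∘ Fin.suc))))

-- ⌊ suc v ≟ suc u ⌋ is not definitionally ⌊ v ≟ u ⌋: _≟_ goes through map′.
when-suc≟suc : (x : ℤ) (v u : Fin n) → x when ⌊ Fin.suc v ≟ Fin.suc u ⌋ ≡ x when ⌊ v ≟ u ⌋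
when-suc≟suc x v u with v ≟ u
... | yes _ = refl
... | no  _ = refl

ΣL-δ : (g : Fin n → ℤ) (u : Fin n) → ΣL (λ v → g v when ⌊ v ≟ u ⌋) ≡ g u
ΣL-δ {suc n} g u@Fin.zero = begin
  ΣL (λ v → g v when ⌊ v ≟ u ⌋)
    ≡⟨ ΣL-suc (λ v → g v when ⌊ v ≟ u ⌋) ⟩
  g u + ΣL {n} (λ _ → + 0)
    ≡⟨ cong (_+_ (g u)) (sumℤ-zero (allFin n)) ⟩
  g u + + 0
    ≡⟨ ℤ.+-identityʳ (g u) ⟩
  g u ∎
  where open ≡-Reasoning
ΣL-δ {suc n} g u@(Fin.suc u′) = begin
  ΣL (λ v → g v when ⌊ v ≟ u ⌋)
    ≡⟨ ΣL-suc (λ v → g v when ⌊ v ≟ u ⌋) ⟩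
  + 0 + ΣL (λ v → g (Fin.suc v) when ⌊ Fin.suc v ≟ u ⌋)
    ≡⟨ ℤ.+-identityˡ _ ⟩
  ΣL (λ v → g (Fin.suc v) when ⌊ Fin.suc v ≟ u ⌋)
    ≡⟨ sumℤ-cong (allFin n) (λ v → when-suc≟suc (g (Fin.suc v)) v u′) ⟩
  ΣL (λ v → g (Fin.suc v) when ⌊ v ≟ u′ ⌋)
    ≡⟨ ΣL-δ (g ∘ Fin.suc) u′ ⟩
  g u ∎
  where open ≡-Reasoning

anyNode≡any : (p : Fin n → Bool) → anyNode p ≡ any p (allFin n)
anyNode≡any {n} p = sym (foldr-map _∨_ p false (allFin n))

anyNode⁻ : (p : Fin n → Bool) → T (anyNode p) → ∃[ w ] T (p w)
anyNode⁻ {n} p h = satisfied (any⁻ p (allFin n) (subst T (anyNode≡any p) h))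

anyNode⁺ : (p : Fin n → Bool) (w : Fin n) → T (p w) → T (anyNode p)
anyNode⁺ p w h = subst T (sym (anyNode≡any p)) (any⁺ p (lose (∈-allFin w) h))

reach-step : (E : Digraph n) (k : ℕ) {v w u : Fin n} →
             T (reach E k v w) → T (E w u) → T (reach E (suc k) v u)
reach-step E k {v} {w} {u} rw ew =
  from T-∨ (inj₂ (anyNode⁺ (λ w → reach E k v w ∧ E w u) w (from T-∧ (rw , ew))))

reach-predecessor-distIs : (E : Digraph n) (k : ℕ) {v w u : Fin n} →
                           T (reach E k v w) → T (E w u) → ¬ T (reach E k v u) → T (distIs E k v w)
reach-predecessor-distIs E zero    rw _  _   = rw
reach-predecessor-distIs E (suc k) {v} {w} rw ew ¬ru with reach E k v w in reach≡true
... | true  = ⊥-elim (¬ru (reach-step E k (subst T (sym reach≡true) _) ew))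
... | false = from T-∧ (rw , _)

distIs-suc⇒predecessor : (E : Digraph n) (k : ℕ) {v u : Fin n} → T (distIs E (suc k) v u) →
                         ∃[ w ] T (E w u) × T (distIs E k v w)
distIs-suc⇒predecessor E k {v} {u} h with reach E k v u in reach≡false
... | true  = ⊥-elim h
... | false =
  let (w , rw∧ew) = anyNode⁻ (λ w → reach E k v w ∧ E w u) (proj₁ (to T-∧ h))
      (rw , ew)   = to T-∧ rw∧ew
  in w , ew , reach-predecessor-distIs E k rw ew (subst T reach≡false)

when-distIs-suc≤ : (E : Digraph n) (k : ℕ) {v u : Fin n} {x : ℤ} → + 0 ≤ℤ x →
                   x when distIs E (suc k) v u ≤ℤ ΣL (λ w → (x when distIs E k v w) when E w u)
when-distIs-suc≤ E k {v} {u} {x} 0≤x with distIs E (suc k) v u in dist≡true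
... | false = sumℤ-nonneg (allFin _) (λ w → when-nonneg (E w u) (when-nonneg (distIs E k v w) 0≤x))
... | true  =
  let (w , ew , dw) = distIs-suc⇒predecessor E k (subst T (sym dist≡true) _)
      xw≡x = trans (when-true (x when distIs E k v w) ew) (when-true x dw)
  in subst (_≤ℤ ΣL (λ w → (x when distIs E k v w) when E w u)) xw≡x
       (≤-sumℤ (allFin _) (λ w → (x when distIs E k v w) when E w u) (∈-allFin w)
          (λ w → when-nonneg (E w u) (when-nonneg (distIs E k v w) 0≤x)))

ΣatDist-suc≤ : (E : Digraph n) (k : ℕ) (u : Fin n) (g : Fin n → ℤ) → (∀ v → + 0 ≤ℤ g v) →
               ΣatDist E (suc k) u g ≤ℤ ΣL (λ w → ΣatDist E k w g when E w u)
ΣatDist-suc≤ {n} E k u g g≥0 = begin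
  ΣL (λ v → g v when distIs E (suc k) v u)
    ≤⟨ sumℤ-mono (allFin n) (λ v → when-distIs-suc≤ E k (g≥0 v)) ⟩
  ΣL (λ v → ΣL (λ w → (g v when distIs E k v w) when E w u))
    ≡⟨ sumℤ-swap (allFin n) (allFin n) (λ v w → (g v when distIs E k v w) when E w u) ⟩
  ΣL (λ w → ΣL (λ v → (g v when distIs E k v w) when E w u))
    ≡⟨ sumℤ-cong (allFin n) (λ w → sumℤ-when (E w u) (allFin n) (λ v → g v when distIs E k v w)) ⟩
  ΣL (λ w → ΣatDist E k w g when E w u) ∎
  where open ℤ.≤-Reasoning

pos-^ : ∀ m t → (+ m) ^ t ≡ + (m ℕ.^ t)
pos-^ m zero    = refl
pos-^ m (suc t) = trans (cong (_*_ (+ m)) (pos-^ m t)) (sym (ℤ.pos-* m (m ℕ.^ t)))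

module Recursion (C : ℕ) (E : Digraph n) where

  σ : ℕ → Fin n → ℤ
  σ t = tbl C E t t

  tbl-stable : ∀ {t s} u → s ≤ t → tbl C E t s u ≡ σ s u
  tbl-stable {zero}      u z≤n   = refl
  tbl-stable {suc t} {s} u s≤1+t with ℕ.m≤n⇒m<n∨m≡n s≤1+t
  ... | inj₂ refl = refl
  ... | inj₁ (s≤s s≤t) with s ≤ᵇ t | ℕ.≤⇒≤ᵇ s≤t
  ...   | true | _ = tbl-stable u s≤t

  -- With t = d − i and k = j − i, shell t k u is the inner sum of the statement and
  -- Σshells t u its left-hand side.
  shell : ℕ → ℕ → Fin n → ℤ
  shell t k u = ΣatDist E k u (σ (t ∸ k))

  Σshells : ℕ → Fin n → ℤ
  Σshells t u = sumℤ (map (λ k → shell t k u) (upTo (suc t)))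

  Σouter-shells : ℕ → Fin n → ℤ
  Σouter-shells t u = sumℤ (map (λ k → shell (suc t) (suc k) u) (upTo (suc t)))

  σ-suc : ∀ t u → σ (suc t) u ≡ (+ C) ^ suc t - Σouter-shells t u
  σ-suc t u = begin
    σ (suc t) u
      ≡⟨ if-cong (dec-false (suc t ≤? t) (ℕ.n≮n t)) ⟩
    (+ C) ^ suc t - Σrange 1 (suc t) (λ k → ΣatDist E k u (tbl C E t (suc t ∸ k)))
      ≡⟨ cong ((+ C) ^ suc t -_) (sumℤ-cong (upTo (suc t)) λ k → sumℤ-cong (allFin n) λ v →
           cong (_when distIs E (suc k) v u) (tbl-stable v (ℕ.m∸n≤m t k))) ⟩
    (+ C) ^ suc t - Σouter-shells t u ∎
    where open ≡-Reasoning

  Σshells≡C^ : ∀ t u → Σshells t u ≡ (+ C) ^ t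
  Σshells≡C^ zero    u = trans (ℤ.+-identityʳ _) (ΣL-δ (σ 0) u)
  Σshells≡C^ (suc t) u = begin
    Σshells (suc t) u
      ≡⟨ sumℤ-upTo-suc (λ k → shell (suc t) k u) (suc t) ⟩
    shell (suc t) 0 u + Σouter-shells t u
      ≡⟨ cong (_+ Σouter-shells t u) (ΣL-δ (σ (suc t)) u) ⟩
    σ (suc t) u + Σouter-shells t u
      ≡⟨ cong (_+ Σouter-shells t u) (σ-suc t u) ⟩
    (+ C) ^ suc t - Σouter-shells t u + Σouter-shells t u
      ≡⟨ //-rightDividesˡ (Σouter-shells t u) ((+ C) ^ suc t) ⟩
    (+ C) ^ suc t ∎
    where open ≡-Reasoning

  Σouter-shells≤ : ∀ t u → (∀ {s} → s ≤ t → ∀ v → + 0 ≤ℤ σ s v) → indeg E u ≤ C →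
                   Σouter-shells t u ≤ℤ (+ C) ^ suc t
  Σouter-shells≤ t u σ≥0 indeg≤C = begin
    Σouter-shells t u
      ≤⟨ sumℤ-mono (upTo (suc t)) (λ k → ΣatDist-suc≤ E k u (σ (t ∸ k)) (σ≥0 (ℕ.m∸n≤m t k))) ⟩
    sumℤ (map (λ k → ΣL (λ w → shell t k w when E w u)) (upTo (suc t)))
      ≡⟨ sumℤ-swap (upTo (suc t)) (allFin n) (λ k w → shell t k w when E w u) ⟩
    ΣL (λ w → sumℤ (map (λ k → shell t k w when E w u) (upTo (suc t))))
      ≡⟨ sumℤ-cong (allFin n) (λ w → sumℤ-when (E w u) (upTo (suc t)) (λ k → shell t k w)) ⟩
    ΣL (λ w → Σshells t w when E w u)
      ≡⟨ sumℤ-cong (allFin n) (λ w → cong (_when E w u) (trans (Σshells≡C^ t w) (pos-^ C t))) ⟩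
    ΣL (λ w → + (C ℕ.^ t) when E w u)
      ≡⟨ sumℤ-const-when (λ w → E w u) (allFin n) (C ℕ.^ t) ⟩
    + (indeg E u ℕ.* C ℕ.^ t)
      ≤⟨ +≤+ (ℕ.*-monoˡ-≤ (C ℕ.^ t) indeg≤C) ⟩
    + (C ℕ.* C ℕ.^ t)
      ≡⟨ pos-^ C (suc t) ⟨
    (+ C) ^ suc t ∎
    where open ℤ.≤-Reasoning

  module _ (indeg≤C : ∀ u → indeg E u ≤ C) where

    σ-nonneg : ∀ t {s} → s ≤ t → ∀ v → + 0 ≤ℤ σ s v
    σ-nonneg zero    z≤n   v = +≤+ z≤n
    σ-nonneg (suc t) s≤1+t v with ℕ.m≤n⇒m<n∨m≡n s≤1+t
    ... | inj₁ (s≤s s≤t) = σ-nonneg t s≤t v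
    ... | inj₂ refl      = subst (+ 0 ≤ℤ_) (sym (σ-suc t v))
                             (ℤ.i≤j⇒0≤j-i (Σouter-shells≤ t v (σ-nonneg t) (indeg≤C v)))

    σ≤C^ : ∀ t u → σ t u ≤ℤ (+ C) ^ t
    σ≤C^ zero    u = ℤ.≤-refl
    σ≤C^ (suc t) u = subst (_≤ℤ (+ C) ^ suc t) (sym (σ-suc t u))
                       (ℤ.i-j≤i _ _ {{nonNegative Σouter-shells≥0}})
      where
      Σouter-shells≥0 : + 0 ≤ℤ Σouter-shells t u
      Σouter-shells≥0 = sumℤ-nonneg (upTo (suc t)) λ k → sumℤ-nonneg (allFin n) λ v →
                          when-nonneg (distIs E (suc k) v u) (σ-nonneg (t ∸ k) ℕ.≤-refl v)

  Σrange≡Σshells : ∀ {i d} u → i ≤ d →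
                   Σrange i d (λ j → ΣatDist E (j ∸ i) u (σ (d ∸ j))) ≡ Σshells (d ∸ i) u
  Σrange≡Σshells {i} {d} u i≤d = begin
    sumℤ (map (λ k → ΣatDist E (i ℕ.+ k ∸ i) u (σ (d ∸ (i ℕ.+ k)))) (upTo (suc d ∸ i)))
      ≡⟨ cong (λ m → sumℤ (map (λ k → ΣatDist E (i ℕ.+ k ∸ i) u (σ (d ∸ (i ℕ.+ k)))) (upTo m)))
              (ℕ.+-∸-assoc 1 i≤d) ⟩
    sumℤ (map (λ k → ΣatDist E (i ℕ.+ k ∸ i) u (σ (d ∸ (i ℕ.+ k)))) (upTo (suc (d ∸ i))))
      ≡⟨ sumℤ-cong (upTo (suc (d ∸ i))) (λ k →
           cong₂ (λ k′ t → ΣatDist E k′ u (σ t)) (ℕ.m+n∸m≡n i k) (sym (ℕ.∸-+-assoc d i k))) ⟩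
    Σshells (d ∸ i) u ∎
    where open ≡-Reasoning

lemma2 : (C : ℕ) → 1 ≤ C → (n : ℕ) → (E : Digraph n) →
         ((u : Fin n) → indeg E u ≤ C) → (d : ℕ) →
         (u : Fin n) → (i : ℕ) → i ≤ d →
         (Σrange i d (λ j → ΣatDist E (j ∸ i) u (λ v → τ C E d v j)) ≡ (+ C) ^ (d ∸ i))
         × ((+ 0) ≤ℤ τ C E d u i × τ C E d u i ≤ℤ (+ C) ^ (d ∸ i))
lemma2 C _ n E indeg≤C d u i i≤d =
  trans (Σrange≡Σshells u i≤d) (Σshells≡C^ (d ∸ i) u) ,
  σ-nonneg indeg≤C (d ∸ i) ℕ.≤-refl u ,
  σ≤C^ indeg≤C (d ∸ i) u
  where open Recursion C E
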